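{- For any base $b\ge2$, $K(2)=b^2+1$ if $b$ is even and $K(2)=b+1$ if $b$ is odd. Equivalently, writing $K(2)=b^{B(2)}+(\text{lower-order terms})$ with $B(2)=\lfloor\log_b K(2)\rfloor$, $B(2)=2$ if $b$ is even and $B(2)=1$ if $b$ is odd.
   Context: Fix a base $b\ge2$. For $v\in\mathbb{N}$, $s(v)$ is the sum of the base-$b$ digits of $v$, $f(v)=v+s(v)$, and $F(u)=|\{v\in\mathbb{N}: f(v)=u\}|$. For $n\ge1$, $K(n)$ denotes the smallest $u\in\mathbb{N}$ with $F(u)=n$. -}

module Defs where

open import Data.Nat using (ℕ; zero; suc; _+_; _≤_; NonZero)
open import Data.Nat.DivMod using (_/_; _%_)
open import Data.Nat.Properties using (_≟_)
open import Data.List using (List; upTo; filter; length)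
open import Data.Product using (_×_)
open import Relation.Binary.PropositionalEquality using (_≡_)

-- sum of base-b digits, computed with fuel; fuel v suffices for b ≥ 2
-- (each step divides by b ≥ 2, so v steps always reach 0)
digitSumFuel : (b : ℕ) → .{{_ : NonZero b}} → ℕ → ℕ → ℕ
digitSumFuel b zero    v = 0
digitSumFuel b (suc k) v = v % b + digitSumFuel b k (v / b)

s : (b : ℕ) → .{{_ : NonZero b}} → ℕ → ℕ
s b v = digitSumFuel b v v

f : (b : ℕ) → .{{_ : NonZero b}} → ℕ → ℕ
f b v = v + s b v

-- F(u) = |{v ∈ ℕ : f(v) = u}|.  Since f(v) ≥ v, every such v lies in
-- {0, …, u}, so the set is exactly the filtered list below.
F : (b : ℕ) → .{{_ : NonZero b}} → ℕ → ℕ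
F b u = length (filter (λ v → f b v ≟ u) (upTo (suc u)))

IsK : (b : ℕ) → .{{_ : NonZero b}} → ℕ → ℕ → Set
IsK b n u = (F b u ≡ n) × (∀ w → F b w ≡ n → u ≤ w)

-- For v < b² with digits v = c + a b one has f v = 2c + a(b + 1).  If b is even, b + 1 is
-- odd and these values are pairwise distinct, so f is injective below m = b²; if b is odd, f
-- is at least injective on single digits (f v = 2v), below m = b.  In both cases s m = 1, so
-- f m = m + 1, and m + 1 has exactly one more preimage x < m (x = 1 + (b − 1) b, resp.
-- x = (b + 1)/2), since f v > v for v > 0.  Every w ≤ m has all its preimages below m, hence
-- at most one of them, so m + 1 is the least value with two preimages.
module Submission where

open import Defs
open import Data.Nat using (ℕ; zero; suc; _+_; _*_; _^_; _≤_; _<_; z≤n; s≤s; s≤s⁻¹; z<s; NonZero; >-nonZero)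
open import Data.Nat.Properties
open import Data.Nat.DivMod
open import Data.Nat.Divisibility using (_∣_; divides; ∣m+n∣m⇒∣n; ∣m∣n⇒∣m+n; ∣-refl; ∣⇒≤; ∣1⇒≡1; 0∣⇒≡0)
open import Data.Nat.Coprimality using (Coprime; coprime-divisor)
open import Data.Nat.Induction using (<-rec)
open import Data.Nat.Tactic.RingSolver using (solve-∀)
open import Data.List using ([]; [_]; _++_; length; filter; upTo)
open import Data.List.Properties using (upTo-∷ʳ; filter-++; filter-accept; filter-reject; length-++)
open import Data.Product using (_×_; _,_; proj₁; proj₂)
open import Data.Sum using (_⊎_; inj₁; inj₂)
open import Function using (_∘_)
open import Relation.Binary.Definitions using (tri<; tri≈; tri>)
open import Relation.Binary.PropositionalEquality hiding ([_])
open import Relation.Nullary using (¬_; yes; no; contradiction)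
open import Relation.Unary using (Pred; Decidable)

InjectiveBelow : ℕ → (ℕ → ℕ) → Set
InjectiveBelow m g = ∀ {v w} → v < m → w < m → g v ≡ g w → v ≡ w

module Counting {ℓ} {P : Pred ℕ ℓ} (P? : Decidable P) where

  count : ℕ → ℕ
  count n = length (filter P? (upTo n))

  count-suc : ∀ n → count (suc n) ≡ count n + length (filter P? [ n ])
  count-suc n = begin
    count (suc n)                                    ≡⟨ cong (λ xs → length (filter P? xs)) (upTo-∷ʳ n) ⟨
    length (filter P? (upTo n ++ [ n ]))             ≡⟨ cong length (filter-++ P? (upTo n) [ n ]) ⟩
    length (filter P? (upTo n) ++ filter P? [ n ])   ≡⟨ length-++ (filter P? (upTo n)) ⟩
    count n + length (filter P? [ n ])               ∎
    where open ≡-Reasoning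

  count-accept : ∀ {n} → P n → count (suc n) ≡ suc (count n)
  count-accept {n} Pn rewrite count-suc n | filter-accept P? {xs = []} Pn = +-comm (count n) 1

  count-reject : ∀ {n} → ¬ P n → count (suc n) ≡ count n
  count-reject {n} ¬Pn rewrite count-suc n | filter-reject P? {xs = []} ¬Pn = +-identityʳ (count n)

  count-stable : ∀ {m n} → m ≤ n → (∀ {v} → m ≤ v → v < n → ¬ P v) → count n ≡ count m
  count-stable {m} {zero} z≤n _ = refl
  count-stable {m} {suc n} m≤1+n absent with m≤n⇒m<n∨m≡n m≤1+n
  ... | inj₂ refl = refl
  ... | inj₁ (s≤s m≤n) = begin
    count (suc n)  ≡⟨ count-reject (absent m≤n ≤-refl) ⟩
    count n        ≡⟨ count-stable m≤n (λ m≤v v<n → absent m≤v (m<n⇒m<1+n v<n)) ⟩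
    count m        ∎
    where open ≡-Reasoning

  count-≤1 : ∀ {n} → (∀ {v w} → v < n → w < n → P v → P w → v ≡ w) → count n ≤ 1
  count-≤1 {zero} _ = z≤n
  count-≤1 {suc n} unique with P? n
  ... | yes Pn = ≤-reflexive (trans (count-accept Pn) (cong suc nothing-below-n))
    where
    nothing-below-n : count n ≡ 0
    nothing-below-n = count-stable z≤n λ _ v<n Pv →
      <-irrefl (unique (m<n⇒m<1+n v<n) ≤-refl Pv Pn) v<n
  ... | no ¬Pn = ≤-trans (≤-reflexive (count-reject ¬Pn))
    (count-≤1 λ v<n w<n → unique (m<n⇒m<1+n v<n) (m<n⇒m<1+n w<n))

  count-≡2 : ∀ {n x y} → x < y → y < n → P x → P y →
             (∀ {v} → v < n → P v → v ≡ x ⊎ v ≡ y) → count n ≡ 2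
  count-≡2 {n} {x} {y} x<y y<n Px Py only-x-y = begin
    count n              ≡⟨ count-stable y<n (λ y<v v<n → absent v<n (>⇒≢ (<-trans x<y y<v)) (>⇒≢ y<v)) ⟩
    count (suc y)        ≡⟨ count-accept Py ⟩
    suc (count y)        ≡⟨ cong suc (count-stable x<y (λ x<v v<y → absent (<-trans v<y y<n) (>⇒≢ x<v) (<⇒≢ v<y))) ⟩
    suc (count (suc x))  ≡⟨ cong suc (count-accept Px) ⟩
    suc (suc (count x))  ≡⟨ cong (suc ∘ suc) (count-stable z≤n (λ _ v<x → absent (<-trans v<x x<n) (<⇒≢ v<x) (<⇒≢ (<-trans v<x x<y)))) ⟩
    2                    ∎
    where
    open ≡-Reasoning
    x<n : x < n
    x<n = <-trans x<y y<n
    absent : ∀ {v} → v < n → v ≢ x → v ≢ y → ¬ P v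
    absent v<n v≢x v≢y Pv with only-x-y v<n Pv
    ... | inj₁ v≡x = v≢x v≡x
    ... | inj₂ v≡y = v≢y v≡y

¬2∣⇒2∣suc : ∀ {n} → ¬ 2 ∣ n → 2 ∣ suc n
¬2∣⇒2∣suc {zero} ¬2∣0 = contradiction (divides 0 refl) ¬2∣0
¬2∣⇒2∣suc {suc zero} _ = ∣-refl
¬2∣⇒2∣suc {suc (suc n)} ¬2∣n+2 = ∣m∣n⇒∣m+n ∣-refl (¬2∣⇒2∣suc (¬2∣n+2 ∘ ∣m∣n⇒∣m+n ∣-refl))

2∣⇒¬2∣suc : ∀ {n} → 2 ∣ n → ¬ 2 ∣ suc n
2∣⇒¬2∣suc {n} 2∣n 2∣1+n = contradiction (∣1⇒≡1 (∣m+n∣m⇒∣n (subst (2 ∣_) (+-comm 1 n) 2∣1+n) 2∣n)) λ ()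

¬2∣⇒coprime-2 : ∀ {n} → ¬ 2 ∣ n → Coprime n 2
¬2∣⇒coprime-2 ¬2∣n {zero} (_ , 0∣2) = contradiction (0∣⇒≡0 0∣2) λ ()
¬2∣⇒coprime-2 ¬2∣n {1} _ = refl
¬2∣⇒coprime-2 ¬2∣n {2} (2∣n , _) = contradiction 2∣n ¬2∣n
¬2∣⇒coprime-2 ¬2∣n {suc (suc (suc _))} (_ , d∣2) with ∣⇒≤ d∣2
... | s≤s (s≤s ())

double+multiple-injective : ∀ {N c c′ a a′} → ¬ 2 ∣ N → c < N → c′ < N →
                            2 * c + a * N ≡ 2 * c′ + a′ * N → c ≡ c′ × a ≡ a′
double+multiple-injective {N} {c} {c′} {a} {a′} N-odd c<N c′<N eq = c≡c′ , a≡a′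
  where
  instance
    _ : NonZero N
    _ = >-nonZero (<-≤-trans z<s c<N)

  ≤⇒≡ : ∀ {c c′ a a′} → c ≤ c′ → c′ < N → 2 * c + a * N ≡ 2 * c′ + a′ * N → c ≡ c′
  ≤⇒≡ {c} {c′} {a} {a′} c≤c′ c′<N eq with m≤n⇒∃[o]m+o≡n c≤c′
  ... | zero , refl = sym (+-identityʳ c)
  -- N ∣ 2 (c′ − c) and N is odd, so N ∣ c′ − c < N.
  ... | suc e , refl = contradiction (∣⇒≤ N∣1+e) (<⇒≱ (≤-<-trans (m≤n+m (suc e) c) c′<N))
    where
    a*N≡a′*N+2*[1+e] : a * N ≡ a′ * N + 2 * suc e
    a*N≡a′*N+2*[1+e] = +-cancelˡ-≡ (2 * c) _ _ (trans eq (rearrange c (suc e) (a′ * N)))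
      where
      rearrange : ∀ c e x → 2 * (c + e) + x ≡ 2 * c + (x + 2 * e)
      rearrange = solve-∀
    N∣1+e : N ∣ suc e
    N∣1+e = coprime-divisor (¬2∣⇒coprime-2 N-odd)
              (∣m+n∣m⇒∣n (subst (N ∣_) a*N≡a′*N+2*[1+e] (divides a refl)) (divides a′ refl))

  c≡c′ : c ≡ c′
  c≡c′ with ≤-total c c′
  ... | inj₁ c≤c′ = ≤⇒≡ {a = a} {a′} c≤c′ c′<N eq
  ... | inj₂ c′≤c = sym (≤⇒≡ {a = a′} {a} c′≤c c<N (sym eq))

  a≡a′ : a ≡ a′
  a≡a′ = *-cancelʳ-≡ a a′ N (+-cancelˡ-≡ (2 * c) _ _ (trans eq (cong (λ z → 2 * z + a′ * N) (sym c≡c′))))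

module Digits (b : ℕ) .{{_ : NonZero b}} (1<b : 1 < b) where

  digitSumFuel-0 : ∀ k → digitSumFuel b k 0 ≡ 0
  digitSumFuel-0 zero = refl
  digitSumFuel-0 (suc k) = cong₂ _+_ (m*n%n≡0 0 b) (trans (cong (digitSumFuel b k) (0/n≡0 b)) (digitSumFuel-0 k))

  /b-≤pred : ∀ {v k} → v ≤ suc k → v / b ≤ k
  /b-≤pred {zero} {k} _ = subst (_≤ k) (sym (0/n≡0 b)) z≤n
  /b-≤pred {suc v} v≤1+k = <⇒≤pred (<-≤-trans (m/n<m (suc v) b 1<b) v≤1+k)

  digitSumFuel-fuel : ∀ {j k v} → v ≤ j → v ≤ k → digitSumFuel b j v ≡ digitSumFuel b k v
  digitSumFuel-fuel {zero} {k} z≤n _ = sym (digitSumFuel-0 k)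
  digitSumFuel-fuel {suc j} {zero} _ z≤n = digitSumFuel-0 (suc j)
  digitSumFuel-fuel {suc j} {suc k} {v} v≤1+j v≤1+k =
    cong (v % b +_) (digitSumFuel-fuel (/b-≤pred v≤1+j) (/b-≤pred v≤1+k))

  s-unfold : ∀ v → s b v ≡ v % b + s b (v / b)
  s-unfold zero = sym (cong₂ _+_ (m*n%n≡0 0 b) (cong (s b) (0/n≡0 b)))
  s-unfold (suc k) = cong (suc k % b +_) (digitSumFuel-fuel (/b-≤pred ≤-refl) ≤-refl)

  s-digit : ∀ {v} → v < b → s b v ≡ v
  s-digit {v} v<b = begin
    s b v                   ≡⟨ s-unfold v ⟩
    v % b + s b (v / b)     ≡⟨ cong₂ (λ c a → c + s b a) (m<n⇒m%n≡m v<b) (m<n⇒m/n≡0 v<b) ⟩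
    v + 0                   ≡⟨ +-identityʳ v ⟩
    v                       ∎
    where open ≡-Reasoning

  s[c+a*b]≡c+s[a] : ∀ {c} a → c < b → s b (c + a * b) ≡ c + s b a
  s[c+a*b]≡c+s[a] {c} a c<b = begin
    s b (c + a * b)                          ≡⟨ s-unfold (c + a * b) ⟩
    (c + a * b) % b + s b ((c + a * b) / b)  ≡⟨ cong₂ (λ r q → r + s b q) last-digit leading-digits ⟩
    c + s b a                                ∎
    where
    open ≡-Reasoning
    last-digit : (c + a * b) % b ≡ c
    last-digit = trans ([m+kn]%n≡m%n c a b) (m<n⇒m%n≡m c<b)
    leading-digits : (c + a * b) / b ≡ a
    leading-digits = begin
      (c + a * b) / b    ≡⟨ +-distrib-/-∣ʳ c (divides a refl) ⟩
      c / b + a * b / b  ≡⟨ cong₂ _+_ (m<n⇒m/n≡0 c<b) (m*n/n≡m a b) ⟩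
      a                  ∎

  s[b]≡1 : s b b ≡ 1
  s[b]≡1 = begin
    s b b            ≡⟨ cong (s b) (+-identityʳ b) ⟨
    s b (0 + 1 * b)  ≡⟨ s[c+a*b]≡c+s[a] 1 (<-trans z<s 1<b) ⟩
    s b 1            ≡⟨ s-digit 1<b ⟩
    1                ∎
    where open ≡-Reasoning

  s[b*b]≡1 : s b (b * b) ≡ 1
  s[b*b]≡1 = trans (s[c+a*b]≡c+s[a] b (<-trans z<s 1<b)) s[b]≡1

  s-positive : ∀ {v} → 0 < v → 0 < s b v
  s-positive {v} = <-rec (λ v → 0 < v → 0 < s b v) step v
    where
    step : ∀ v → (∀ {w} → w < v → 0 < w → 0 < s b w) → 0 < v → 0 < s b v
    step v rec 0<v with v % b in v%b≡r
    ... | suc r = <-≤-trans (subst (0 <_) (sym v%b≡r) z<s) v%b≤s[v]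
      where
      v%b≤s[v] : v % b ≤ s b v
      v%b≤s[v] = subst (v % b ≤_) (sym (s-unfold v)) (m≤m+n (v % b) _)
    ... | zero = <-≤-trans (rec (m/n<m v b {{>-nonZero 0<v}} 1<b) 0<v/b) s[v/b]≤s[v]
      where
      s[v/b]≤s[v] : s b (v / b) ≤ s b v
      s[v/b]≤s[v] = subst (s b (v / b) ≤_) (sym (s-unfold v)) (m≤n+m _ (v % b))
      0<v/b : 0 < v / b
      0<v/b = n≢0⇒n>0 λ v/b≡0 →
        <-irrefl (sym (trans (m≡m%n+[m/n]*n v b) (cong₂ (λ r q → r + q * b) v%b≡r v/b≡0))) 0<v

  f-inflationary : ∀ {v} → 0 < v → v < f b v
  f-inflationary {v} 0<v = m<m+n v (s-positive 0<v)

  f-digit : ∀ {v} → v < b → f b v ≡ 2 * v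
  f-digit {v} v<b = cong (v +_) (trans (s-digit v<b) (sym (+-identityʳ v)))

  f-twoDigits : ∀ {v} → v < b * b → f b v ≡ 2 * (v % b) + v / b * suc b
  f-twoDigits {v} v<b*b = begin
    v + s b v                          ≡⟨ cong (v +_) (s-unfold v) ⟩
    v + (v % b + s b (v / b))          ≡⟨ cong (λ t → v + (v % b + t)) (s-digit (m<n*o⇒m/o<n v<b*b)) ⟩
    v + (v % b + v / b)                ≡⟨ cong (_+ (v % b + v / b)) (m≡m%n+[m/n]*n v b) ⟩
    v % b + v / b * b + (v % b + v / b) ≡⟨ collect (v % b) (v / b) b ⟩
    2 * (v % b) + v / b * suc b        ∎
    where
    open ≡-Reasoning
    collect : ∀ c a b → c + a * b + (c + a) ≡ 2 * c + a * suc b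
    collect = solve-∀

  f-injectiveBelow-b : InjectiveBelow b (f b)
  f-injectiveBelow-b v<b w<b eq =
    *-cancelˡ-≡ _ _ 2 (trans (sym (f-digit v<b)) (trans eq (f-digit w<b)))

  f-injectiveBelow-b*b : ¬ 2 ∣ suc b → InjectiveBelow (b * b) (f b)
  f-injectiveBelow-b*b 1+b-odd {v} {w} v<b*b w<b*b eq = begin
    v                  ≡⟨ m≡m%n+[m/n]*n v b ⟩
    v % b + v / b * b  ≡⟨ cong₂ (λ c a → c + a * b) (proj₁ same-digits) (proj₂ same-digits) ⟩
    w % b + w / b * b  ≡⟨ m≡m%n+[m/n]*n w b ⟨
    w                  ∎
    where
    open ≡-Reasoning
    same-digits : v % b ≡ w % b × v / b ≡ w / b
    same-digits = double+multiple-injective 1+b-odd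
      (m<n⇒m<1+n (m%n<n v b)) (m<n⇒m<1+n (m%n<n w b))
      (trans (sym (f-twoDigits v<b*b)) (trans eq (f-twoDigits w<b*b)))

  IsK-2-criterion : ∀ {m x} → x < m → f b x ≡ m + 1 → s b m ≡ 1 → InjectiveBelow m (f b) →
                    IsK b 2 (m + 1)
  IsK-2-criterion {m} {x} x<m f[x]≡m+1 s[m]≡1 injective =
    subst (IsK b 2) (sym m+1≡1+m) (F≡2 , minimal)
    where
    open Counting

    m+1≡1+m : m + 1 ≡ suc m
    m+1≡1+m = +-comm m 1

    f[x]≡1+m : f b x ≡ suc m
    f[x]≡1+m = trans f[x]≡m+1 m+1≡1+m

    f[m]≡1+m : f b m ≡ suc m
    f[m]≡1+m = trans (cong (m +_) s[m]≡1) m+1≡1+m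

    preimages : ∀ {v} → v < suc (suc m) → f b v ≡ suc m → v ≡ x ⊎ v ≡ m
    preimages {v} _ f[v]≡1+m with <-cmp v m
    ... | tri< v<m _ _ = inj₁ (injective v<m x<m (trans f[v]≡1+m (sym f[x]≡1+m)))
    ... | tri≈ _ v≡m _ = inj₂ v≡m
    ... | tri> _ _ m<v =
      contradiction (subst (_≤ v) (sym f[v]≡1+m) m<v) (<⇒≱ (f-inflationary (<-≤-trans z<s m<v)))

    F≡2 : F b (suc m) ≡ 2
    F≡2 = count-≡2 (λ v → f b v ≟ suc m) x<m (m<n⇒m<1+n (n<1+n m)) f[x]≡1+m f[m]≡1+m preimages

    below-m : ∀ {v w} → w < suc m → v < suc w → f b v ≡ w → v < m
    below-m {v} {w} w<1+m v<1+w f[v]≡w = ≤∧≢⇒< (≤-trans (s≤s⁻¹ v<1+w) (s≤s⁻¹ w<1+m))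
      λ { refl → <-irrefl (trans (sym f[v]≡w) f[m]≡1+m) w<1+m }

    F≤1-below : ∀ {w} → w < suc m → F b w ≤ 1
    F≤1-below {w} w<1+m = count-≤1 (λ v → f b v ≟ w) λ v<1+w v′<1+w f[v]≡w f[v′]≡w →
      injective (below-m w<1+m v<1+w f[v]≡w) (below-m w<1+m v′<1+w f[v′]≡w) (trans f[v]≡w (sym f[v′]≡w))

    minimal : ∀ w → F b w ≡ 2 → suc m ≤ w
    minimal w F[w]≡2 = ≮⇒≥ λ w<1+m → contradiction (subst (_≤ 1) F[w]≡2 (F≤1-below w<1+m)) λ { (s≤s ()) }

  1+p*b<b*b : ∀ {p} → suc p ≡ b → 1 + p * b < b * b
  1+p*b<b*b {p} refl = +-monoˡ-< (p * b) 1<b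

  f[1+p*b]≡b*b+1 : ∀ {p} → suc p ≡ b → f b (1 + p * b) ≡ b * b + 1
  f[1+p*b]≡b*b+1 {p} refl = begin
    (1 + p * b) + s b (1 + p * b)  ≡⟨ cong ((1 + p * b) +_) (s[c+a*b]≡c+s[a] p 1<b) ⟩
    (1 + p * b) + (1 + s b p)      ≡⟨ cong (λ t → (1 + p * b) + (1 + t)) (s-digit ≤-refl) ⟩
    (1 + p * b) + (1 + p)          ≡⟨ expand p ⟩
    b * b + 1                      ∎
    where
    open ≡-Reasoning
    expand : ∀ p → (1 + p * suc p) + (1 + p) ≡ suc p * suc p + 1
    expand = solve-∀

  half<b : ∀ q → suc b ≡ q * 2 → q < b
  half<b q 1+b≡q*2 = *-cancelˡ-< 2 q b (begin-strict
    2 * q    ≡⟨ *-comm 2 q ⟩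
    q * 2    ≡⟨ 1+b≡q*2 ⟨
    1 + b    <⟨ +-monoˡ-< b 1<b ⟩
    b + b    ≡⟨ cong (b +_) (+-identityʳ b) ⟨
    2 * b    ∎)
    where open ≤-Reasoning

  f[half]≡b+1 : ∀ q → suc b ≡ q * 2 → f b q ≡ b + 1
  f[half]≡b+1 q 1+b≡q*2 = begin
    f b q  ≡⟨ f-digit (half<b q 1+b≡q*2) ⟩
    2 * q  ≡⟨ *-comm 2 q ⟩
    q * 2  ≡⟨ 1+b≡q*2 ⟨
    1 + b  ≡⟨ +-comm 1 b ⟩
    b + 1  ∎
    where open ≡-Reasoning

theorem4p2 : (b : ℕ) → .{{_ : NonZero b}} → 2 ≤ b →
    ((2 ∣ b) → IsK b 2 (b ^ 2 + 1)) × ((¬ (2 ∣ b)) → IsK b 2 (b + 1))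
theorem4p2 b 2≤b = even , odd
  where
  open Digits b 2≤b

  even : 2 ∣ b → IsK b 2 (b ^ 2 + 1)
  even 2∣b = subst (λ b² → IsK b 2 (b² + 1)) (cong (b *_) (sym (*-identityʳ b)))
    (IsK-2-criterion (1+p*b<b*b (suc-pred b)) (f[1+p*b]≡b*b+1 (suc-pred b)) s[b*b]≡1
      (f-injectiveBelow-b*b (2∣⇒¬2∣suc 2∣b)))

  odd : ¬ 2 ∣ b → IsK b 2 (b + 1)
  odd ¬2∣b with ¬2∣⇒2∣suc ¬2∣b
  ... | divides q 1+b≡q*2 = IsK-2-criterion (half<b q 1+b≡q*2) (f[half]≡b+1 q 1+b≡q*2) s[b]≡1 f-injectiveBelow-b
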